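{- If $n\ge 7$ is odd, then $w_3=(3n-1)/2$ and $W_3=\{\mathbf{b}_1,\mathbf{b}_3,\mathbf{b}_5\}$, where $\mathbf{b}_1=\overline{10}[n]$, $\mathbf{b}_3=\overline{0}[n-2]\cdot 11$ and $\mathbf{b}_5=11\cdot\overline{0}[n-2]$.
   Context: For $\mathbf{x}=(x_0,\ldots,x_{n-1})\in\mathbb{F}_2^n$, the derivative is $\partial\mathbf{x}=(x_0+x_1,\ldots,x_{n-2}+x_{n-1})\in\mathbb{F}_2^{n-1}$, with $\partial^0\mathbf{x}=\mathbf{x}$ and $\partial^i\mathbf{x}=\partial(\partial^{i-1}\mathbf{x})$. The Steinhaus triangle is $T(\mathbf{x})=(\mathbf{x},\partial\mathbf{x},\ldots,\partial^{n-1}\mathbf{x})$; $|\mathbf{y}|$ is the number of ones of a binary sequence and $|T(\mathbf{x})|=\sum_{i=0}^{n-1}|\partial^i\mathbf{x}|$. For fixed $n$, let $0=w_0<w_1<\cdots<w_m$ be the distinct values of $|T(\mathbf{x})|$ over $\mathbf{x}\in\mathbb{F}_2^n$, and $W_i=\{\mathbf{x}\in\mathbb{F}_2^n:|T(\mathbf{x})|=w_i\}$. Sequences are written as words; a dot denotes concatenation; $\overline{x_1\cdots x_p}[k]$ is the word of the first $k$ letters of the infinite periodic word $x_1\cdots x_px_1\cdots x_p\cdots$. -}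

module Defs where

open import Data.Bool using (Bool; true; false; _xor_; if_then_else_)
open import Data.Nat using (ℕ; zero; suc; _+_; _*_; _∸_; _<ᵇ_; _≡ᵇ_; _/_; _%_)
open import Data.Vec using (Vec; []; _∷_; tabulate; count)
open import Data.Fin using (Fin; toℕ)
open import Data.List as List using (List; filterᵇ; upTo; head; drop; concatMap)
open import Data.Bool.ListAction using (any)
import Data.List
open import Data.Maybe using (Maybe)
open import Relation.Nullary.Decidable using (does)
open import Data.Bool.Properties using (T?)

ones : ∀ {n} → Vec Bool n → ℕ
ones [] = 0
ones (true ∷ xs) = suc (ones xs)
ones (false ∷ xs) = ones xs

∂ : ∀ {n} → Vec Bool (suc n) → Vec Bool n
∂ (x ∷ []) = []
∂ (x ∷ y ∷ ys) = (x xor y) ∷ ∂ (y ∷ ys)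

-- |T(x)| = Σ_{i=0}^{n-1} |∂^i x|
weightT : ∀ n → Vec Bool n → ℕ
weightT zero [] = 0
weightT (suc n) xs = ones xs + weightT n (∂ xs)

allVecs : ∀ n → List (Vec Bool n)
allVecs zero = [] List.∷ List.[]
allVecs (suc n) = concatMap (λ v → (false ∷ v) List.∷ (true ∷ v) List.∷ List.[]) (allVecs n)

attained : ℕ → ℕ → Bool
attained n v = any (λ x → weightT n x ≡ᵇ v) (allVecs n)

-- the distinct values w_0 < w_1 < ... < w_m of |T(x)|, in increasing order
-- (every value is ≤ n(n+1)/2, the number of entries of the triangle)
distinctWeights : ℕ → List ℕ
distinctWeights n = filterᵇ (attained n) (upTo (suc (n * suc n)))

w : ℕ → ℕ → Maybe ℕ
w n i = head (drop i (distinctWeights n))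

b₁ : ∀ n → Vec Bool n
b₁ n = tabulate (λ i → (toℕ i % 2) ≡ᵇ 0)

b₃ : ∀ n → Vec Bool n
b₃ n = tabulate (λ i → (n ∸ 2) <ᵇ suc (toℕ i))

b₅ : ∀ n → Vec Bool n
b₅ n = tabulate (λ i → toℕ i <ᵇ 2)

-- Call the words 0ⁿ, 1ⁿ, 10ⁿ⁻¹, 010ⁿ⁻², 110ⁿ⁻², 0ⁿ⁻¹1, 0ⁿ⁻²10, 0ⁿ⁻²11, 1010⋯ and 0101⋯
-- light.  For n ≥ 8 every word of length n is light or has weight at least β n + 2, where
-- β n = ⌊(3n − 1)/2⌋, by induction on n through |T x| = |x| + |T ∂x|.  If ∂x is light, x is
-- one of the two primitives of ∂x, which are complementary; a case check shows that each is
-- light or has at least n − 2 ones, which makes it heavy, and that both primitives of an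
-- alternating word are heavy.  If ∂x is heavy, so is x unless x has at most one 1; a single 1
-- away from both ends makes ∂²x a word with two ones whose derivative has at least three, so
-- ∂²x is not light and the induction hypothesis at n − 2 applies to it.  For odd n the light
-- weights are 0, n, β n − 1 and β n, the last attained exactly by b₁, b₃ and b₅.  Lengths 7,
-- 8 and 9 are settled by enumerating all words.

module Submission where

open import Defs
open import Data.Nat using (ℕ; zero; suc; _+_; _*_; _∸_; _≤_; _<_; _≤?_; _<?_; _≡ᵇ_; z≤n; s≤s; _/_; _%_)
open import Data.Nat.Properties using
  ( _≟_; ≤-refl; ≤-trans; ≤-reflexive; ≤-pred; n≤1+n; m≤m+n; m≤n+m; m≤m*n; suc-injective
  ; +-assoc; +-comm; +-suc; +-identityʳ; +-monoˡ-≤; +-monoʳ-≤; +-mono-≤; +-cancelʳ-≤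
  ; *-suc; *-monoʳ-≤; *-cancelˡ-≤; *-distribˡ-+
  ; m≤n⇒m<n∨m≡n; m<n⇒m<1+n; <-irrefl; <-trans; <-≤-trans; ≡ᵇ⇒≡; ≡⇒≡ᵇ; module ≤-Reasoning )
open import Data.Nat.Tactic.RingSolver using (solve-∀)
open import Data.Nat.DivMod using (m*n/n≡m; m≡m%n+[m/n]*n)
open import Data.Bool using (Bool; true; false; not; _xor_; T)
import Data.Bool.Properties as Bool
open import Data.Bool.Properties using (T?; xor-same; xor-identityʳ; xor-assoc; xor-inverseʳ; xor-annihilates-not)
open import Data.Vec as Vec using (Vec; []; _∷_; _∷ʳ_; _++_; head; replicate; map)
open import Data.Vec.Properties using (map-replicate) renaming (≡-dec to ≡-decᵥ)
open import Data.Product using (_×_; _,_; proj₁; proj₂; ∃; ∃-syntax)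
open import Data.Sum using (_⊎_; inj₁; inj₂)
open import Data.Maybe using (just)
open import Data.List as List using (List; []; _∷_; [_]; filterᵇ; upTo)
open import Data.List.Properties using (filter-++; filter-accept; filter-reject; upTo-∷ʳ; ++-identityʳ; ++-assoc)
open import Data.List.Relation.Unary.Any.Properties using (any⁺; any⁻)
open import Data.List.Membership.Propositional using (_∈_)
open import Data.List.Membership.Propositional.Properties using (∈-concatMap⁺)
open import Data.List.Relation.Unary.Any as Any using (Any; here; there; any?)
open import Data.List.Relation.Unary.All as All using (all?)
open import Data.Unit using (tt)
open import Data.Empty using (⊥-elim)
open import Function using (_∘_)
open import Function.Bundles using (_⇔_; mk⇔)
open import Relation.Nullary using (¬_)
open import Relation.Nullary.Decidable using (True; toWitness; _⊎-dec_)
open import Relation.Unary using (Decidable)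
open import Relation.Binary.PropositionalEquality using (_≡_; refl; sym; trans; cong; cong₂; subst; module ≡-Reasoning)

∣T_∣ : ∀ {n} → Vec Bool n → ℕ
∣T_∣ {n} x = weightT n x

-- For n ≥ 1, β n = ⌊(3n − 1)/2⌋ and π n = ⌊(3n − 2)/2⌋: the weights of 0ⁿ⁻²11 and 0ⁿ⁻²10.
β π : ℕ → ℕ
β zero = 0
β (suc zero) = 1
β (suc (suc n)) = 2 + π (suc n)
π zero = 0
π (suc zero) = 0
π (suc (suc n)) = 1 + β (suc n)

π≤β : ∀ n → π n ≤ β n
β≤1+π : ∀ n → β n ≤ suc (π n)
π≤β zero = z≤n
π≤β (suc zero) = z≤n
π≤β (suc (suc n)) = s≤s (β≤1+π (suc n))
β≤1+π zero = z≤n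
β≤1+π (suc zero) = s≤s z≤n
β≤1+π (suc (suc n)) = s≤s (s≤s (π≤β (suc n)))

β-suc-≤ : ∀ n → β (suc n) ≤ 2 + β n
β-suc-≤ zero = s≤s z≤n
β-suc-≤ (suc n) = s≤s (s≤s (π≤β (suc n)))

β+2≤2[n-2] : ∀ j → β (10 + j) + 2 ≤ (8 + j) + (8 + j)
β+2≤2[n-2] zero = ≤-refl
β+2≤2[n-2] (suc zero) = ≤-refl
β+2≤2[n-2] (suc (suc j)) =
  ≤-trans (s≤s (s≤s (s≤s (β+2≤2[n-2] j)))) (≤-trans (n≤1+n _) (≤-reflexive (grow j)))
  where
  grow : ∀ j → 4 + ((8 + j) + (8 + j)) ≡ (10 + j) + (10 + j)
  grow = solve-∀

β+4≤n+q : ∀ j q → β (10 + j) ≤ 2 + q → β (10 + j) + 4 ≤ (10 + j) + q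
β+4≤n+q j q le = begin
  β (10 + j) + 4      ≤⟨ +-monoˡ-≤ 4 le ⟩
  2 + q + 4           ≡⟨ +-comm (2 + q) 4 ⟩
  6 + q               ≤⟨ +-monoˡ-≤ q (m≤m+n 6 (4 + j)) ⟩
  (10 + j) + q        ∎
  where open ≤-Reasoning

β+4≤n+[n-1] : ∀ j → β (10 + j) + 4 ≤ (10 + j) + (9 + j)
β+4≤n+[n-1] j = begin
  β (10 + j) + 4          ≡⟨ sym (+-assoc (β (10 + j)) 2 2) ⟩
  β (10 + j) + 2 + 2      ≤⟨ +-monoˡ-≤ 2 (β+2≤2[n-2] j) ⟩
  (8 + j) + (8 + j) + 2   ≤⟨ n≤1+n _ ⟩
  suc ((8 + j) + (8 + j) + 2) ≡⟨ rearrange j ⟩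
  (10 + j) + (9 + j)      ∎
  where
  open ≤-Reasoning
  rearrange : ∀ j → suc ((8 + j) + (8 + j) + 2) ≡ (10 + j) + (9 + j)
  rearrange = solve-∀

0ⁿ 1ⁿ : ∀ n → Vec Bool n
0ⁿ n = replicate n false
1ⁿ n = replicate n true

alternating : Bool → ∀ n → Vec Bool n
alternating b zero = []
alternating b (suc n) = b ∷ alternating (not b) n

∂-replicate : ∀ n b → ∂ (replicate (suc n) b) ≡ 0ⁿ n
∂-replicate zero b = refl
∂-replicate (suc n) b = cong₂ _∷_ (xor-same b) (∂-replicate n b)

∂-∷-0ⁿ : ∀ n b → ∂ (b ∷ 0ⁿ (suc n)) ≡ b ∷ 0ⁿ n
∂-∷-0ⁿ n b = cong₂ _∷_ (xor-identityʳ b) (∂-replicate n false)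

∂-0ⁿ-∷ʳ : ∀ n c → ∂ (0ⁿ (suc n) ∷ʳ c) ≡ 0ⁿ n ∷ʳ c
∂-0ⁿ-∷ʳ zero c = refl
∂-0ⁿ-∷ʳ (suc n) c = cong (false ∷_) (∂-0ⁿ-∷ʳ n c)

∂-0ⁿ-∷ʳ-∷ʳ : ∀ n c d → ∂ (0ⁿ (suc n) ∷ʳ c ∷ʳ d) ≡ 0ⁿ n ∷ʳ c ∷ʳ (c xor d)
∂-0ⁿ-∷ʳ-∷ʳ zero c d = refl
∂-0ⁿ-∷ʳ-∷ʳ (suc n) c d = cong (false ∷_) (∂-0ⁿ-∷ʳ-∷ʳ n c d)

∂-alternating : ∀ b n → ∂ (alternating b (suc n)) ≡ 1ⁿ n
∂-alternating b zero = refl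
∂-alternating b (suc n) = cong₂ _∷_ (xor-inverseʳ b) (∂-alternating (not b) n)

map-not-alternating : ∀ b n → map not (alternating b n) ≡ alternating (not b) n
map-not-alternating b zero = refl
map-not-alternating b (suc n) = cong (not b ∷_) (map-not-alternating (not b) n)

ones-0ⁿ : ∀ n → ones (0ⁿ n) ≡ 0
ones-0ⁿ zero = refl
ones-0ⁿ (suc n) = ones-0ⁿ n

ones≡0⇒0ⁿ : ∀ {n} (x : Vec Bool n) → ones x ≡ 0 → x ≡ 0ⁿ n
ones≡0⇒0ⁿ [] _ = refl
ones≡0⇒0ⁿ (false ∷ x) e = cong (false ∷_) (ones≡0⇒0ⁿ x e)

ones-1ⁿ : ∀ n → ones (1ⁿ n) ≡ n
ones-1ⁿ zero = refl
ones-1ⁿ (suc n) = cong suc (ones-1ⁿ n)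

ones-0ⁿ-∷ʳ : ∀ n c → ones (0ⁿ n ∷ʳ c) ≡ ones (c ∷ [])
ones-0ⁿ-∷ʳ zero c = refl
ones-0ⁿ-∷ʳ (suc n) c = ones-0ⁿ-∷ʳ n c

ones-0ⁿ-∷ʳ-∷ʳ : ∀ n c d → ones (0ⁿ n ∷ʳ c ∷ʳ d) ≡ ones (c ∷ d ∷ [])
ones-0ⁿ-∷ʳ-∷ʳ zero c d = refl
ones-0ⁿ-∷ʳ-∷ʳ (suc n) c d = ones-0ⁿ-∷ʳ-∷ʳ n c d

ones-alternating-true : ∀ m → m ≤ 2 * ones (alternating true m)
ones-alternating-true zero = z≤n
ones-alternating-true (suc zero) = s≤s z≤n
ones-alternating-true (suc (suc m)) =
  ≤-trans (s≤s (s≤s (ones-alternating-true m))) (≤-reflexive (sym (*-suc 2 _)))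

ones-alternating : ∀ b m → m ≤ suc (2 * ones (alternating b m))
ones-alternating true m = ≤-trans (ones-alternating-true m) (n≤1+n _)
ones-alternating false zero = z≤n
ones-alternating false (suc m) = s≤s (ones-alternating-true m)

weight-from : ∀ {n} (x : Vec Bool (suc n)) {y : Vec Bool n} {o w} →
  ones x ≡ o → ∂ x ≡ y → ∣T y ∣ ≡ w → ∣T x ∣ ≡ o + w
weight-from x refl refl refl = refl

weight-0ⁿ : ∀ n → ∣T 0ⁿ n ∣ ≡ 0
weight-0ⁿ zero = refl
weight-0ⁿ (suc n) = weight-from (0ⁿ (suc n)) (ones-0ⁿ n) (∂-replicate n false) (weight-0ⁿ n)

weight-1ⁿ : ∀ n → ∣T 1ⁿ n ∣ ≡ n
weight-1ⁿ zero = refl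
weight-1ⁿ (suc n) =
  trans (weight-from (1ⁿ (suc n)) (ones-1ⁿ (suc n)) (∂-replicate n true) (weight-0ⁿ n)) (+-identityʳ _)

weight-10ⁿ : ∀ n → ∣T true ∷ 0ⁿ n ∣ ≡ suc n
weight-10ⁿ zero = refl
weight-10ⁿ (suc n) =
  weight-from (true ∷ 0ⁿ (suc n)) (cong suc (ones-0ⁿ n)) (∂-∷-0ⁿ n true) (weight-10ⁿ n)

weight-0ⁿ1 : ∀ n → ∣T 0ⁿ n ∷ʳ true ∣ ≡ suc n
weight-0ⁿ1 zero = refl
weight-0ⁿ1 (suc n) =
  weight-from (0ⁿ (suc n) ∷ʳ true) (ones-0ⁿ-∷ʳ n true) (∂-0ⁿ-∷ʳ n true) (weight-0ⁿ1 n)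

weight-010ⁿ : ∀ n → ∣T false ∷ true ∷ 0ⁿ n ∣ ≡ π (2 + n)
weight-110ⁿ : ∀ n → ∣T true ∷ true ∷ 0ⁿ n ∣ ≡ β (2 + n)
weight-010ⁿ zero = refl
weight-010ⁿ (suc n) =
  weight-from (false ∷ true ∷ 0ⁿ (suc n)) (cong suc (ones-0ⁿ n)) (cong (true ∷_) (∂-∷-0ⁿ n true))
    (weight-110ⁿ n)
weight-110ⁿ zero = refl
weight-110ⁿ (suc n) =
  weight-from (true ∷ true ∷ 0ⁿ (suc n)) (cong (2 +_) (ones-0ⁿ n)) (cong (false ∷_) (∂-∷-0ⁿ n true))
    (weight-010ⁿ n)

weight-0ⁿ10 : ∀ n → ∣T 0ⁿ n ∷ʳ true ∷ʳ false ∣ ≡ π (2 + n)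
weight-0ⁿ11 : ∀ n → ∣T 0ⁿ n ∷ʳ true ∷ʳ true ∣ ≡ β (2 + n)
weight-0ⁿ10 zero = refl
weight-0ⁿ10 (suc n) =
  weight-from (0ⁿ (suc n) ∷ʳ true ∷ʳ false) (ones-0ⁿ-∷ʳ-∷ʳ n true false) (∂-0ⁿ-∷ʳ-∷ʳ n true false)
    (weight-0ⁿ11 n)
weight-0ⁿ11 zero = refl
weight-0ⁿ11 (suc n) =
  weight-from (0ⁿ (suc n) ∷ʳ true ∷ʳ true) (ones-0ⁿ-∷ʳ-∷ʳ n true true) (∂-0ⁿ-∷ʳ-∷ʳ n true true)
    (weight-0ⁿ10 n)

weight-alternating : ∀ b n → ∣T alternating b (suc n) ∣ ≡ ones (alternating b (suc n)) + n
weight-alternating b n = weight-from (alternating b (suc n)) refl (∂-alternating b n) (weight-1ⁿ n)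

-- Primitives and complements

∫ : ∀ {n} → Bool → Vec Bool n → Vec Bool (suc n)
∫ b [] = b ∷ []
∫ b (y ∷ ys) = b ∷ ∫ (b xor y) ys

xor-cancelˡ : ∀ a b → a xor (a xor b) ≡ b
xor-cancelˡ a b = trans (sym (xor-assoc a a b)) (cong (_xor b) (xor-same a))

∂-∫ : ∀ {n} b (y : Vec Bool n) → ∂ (∫ b y) ≡ y
∂-∫ b [] = refl
∂-∫ b (y ∷ []) = cong (_∷ []) (xor-cancelˡ b y)
∂-∫ b (y ∷ z ∷ zs) = cong₂ _∷_ (xor-cancelˡ b y) (∂-∫ (b xor y) (z ∷ zs))

∫-∂ : ∀ {n} (x : Vec Bool (suc n)) → ∫ (head x) (∂ x) ≡ x
∫-∂ (a ∷ []) = refl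
∫-∂ (a ∷ b ∷ xs) =
  cong (a ∷_) (trans (cong (λ c → ∫ c (∂ (b ∷ xs))) (xor-cancelˡ a b)) (∫-∂ (b ∷ xs)))

∂-injective : ∀ {n} {x y : Vec Bool (suc n)} → head x ≡ head y → ∂ x ≡ ∂ y → x ≡ y
∂-injective {x = x} {y} h d = trans (sym (∫-∂ x)) (trans (cong₂ ∫ h d) (∫-∂ y))

∂-complement : ∀ {n} (x : Vec Bool (suc n)) → ∂ (map not x) ≡ ∂ x
∂-complement (a ∷ []) = refl
∂-complement (a ∷ b ∷ xs) = cong₂ _∷_ (xor-annihilates-not a b) (∂-complement (b ∷ xs))

ones-complement : ∀ {n} (x : Vec Bool n) → ones x + ones (map not x) ≡ n
ones-complement [] = refl
ones-complement (true ∷ xs) = cong suc (ones-complement xs)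
ones-complement (false ∷ xs) = trans (+-suc (ones xs) _) (cong suc (ones-complement xs))

∂x≡∂y⇒x≡y∨x≡¬y : ∀ {n} (x y : Vec Bool (suc n)) → ∂ x ≡ ∂ y → x ≡ y ⊎ x ≡ map not y
∂x≡∂y⇒x≡y∨x≡¬y (true ∷ _) (true ∷ _) d = inj₁ (∂-injective refl d)
∂x≡∂y⇒x≡y∨x≡¬y (false ∷ _) (false ∷ _) d = inj₁ (∂-injective refl d)
∂x≡∂y⇒x≡y∨x≡¬y (true ∷ _) y@(false ∷ _) d = inj₂ (∂-injective refl (trans d (sym (∂-complement y))))
∂x≡∂y⇒x≡y∨x≡¬y (false ∷ _) y@(true ∷ _) d = inj₂ (∂-injective refl (trans d (sym (∂-complement y))))

ones-∫-alternating-true : ∀ c m → m ≤ 2 * ones (∫ c (alternating true m))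
ones-∫-alternating-true c zero = z≤n
ones-∫-alternating-true true (suc zero) = s≤s z≤n
ones-∫-alternating-true false (suc zero) = s≤s z≤n
ones-∫-alternating-true true (suc (suc m)) =
  ≤-trans (s≤s (s≤s (ones-∫-alternating-true false m))) (≤-reflexive (sym (*-suc 2 _)))
ones-∫-alternating-true false (suc (suc m)) =
  ≤-trans (s≤s (s≤s (ones-∫-alternating-true true m))) (≤-reflexive (sym (*-suc 2 _)))

ones-∫-alternating : ∀ c b m → m ≤ suc (2 * ones (∫ c (alternating b m)))
ones-∫-alternating c true m = ≤-trans (ones-∫-alternating-true c m) (n≤1+n _)
ones-∫-alternating c false zero = z≤n
ones-∫-alternating true false (suc m) =
  s≤s (≤-trans (ones-∫-alternating-true true m) (*-monoʳ-≤ 2 (n≤1+n _)))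
ones-∫-alternating false false (suc m) = s≤s (ones-∫-alternating-true false m)

-- Light words and the inductive step through ∂x

data Light : ∀ {n} → Vec Bool n → Set where
  0ⁿ-light : ∀ {n} → Light (0ⁿ n)
  1ⁿ-light : ∀ {n} → Light (1ⁿ n)
  10ⁿ-light : ∀ {n} → Light (true ∷ 0ⁿ n)
  010ⁿ-light : ∀ {n} → Light (false ∷ true ∷ 0ⁿ n)
  110ⁿ-light : ∀ {n} → Light (true ∷ true ∷ 0ⁿ n)
  0ⁿ1-light : ∀ {n} → Light (0ⁿ n ∷ʳ true)
  0ⁿ10-light : ∀ {n} → Light (0ⁿ n ∷ʳ true ∷ʳ false)
  0ⁿ11-light : ∀ {n} → Light (0ⁿ n ∷ʳ true ∷ʳ true)
  alternating-light : ∀ b {n} → Light (alternating b n)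

Classified : ∀ {n} → Vec Bool n → Set
Classified {n} x = Light x ⊎ β n + 2 ≤ ∣T x ∣

Dichotomy : ℕ → Set
Dichotomy n = (x : Vec Bool n) → Classified x

complement-heavy : ∀ {n} (X : Vec Bool (suc n)) → ones X ≤ 2 →
  β (suc n) + 4 ≤ suc n + ∣T ∂ X ∣ → β (suc n) + 2 ≤ ∣T map not X ∣
complement-heavy {n} X few bound = +-cancelʳ-≤ 2 _ _ (begin
  β (suc n) + 2 + 2                 ≡⟨ +-assoc (β (suc n)) 2 2 ⟩
  β (suc n) + 4                     ≤⟨ bound ⟩
  suc n + ∣T ∂ X ∣                  ≡⟨ cong (_+ ∣T ∂ X ∣) (sym (ones-complement X)) ⟩
  ones X + ones ¬X + ∣T ∂ X ∣        ≤⟨ +-monoˡ-≤ _ (+-monoˡ-≤ _ few) ⟩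
  2 + ones ¬X + ∣T ∂ X ∣             ≡⟨ +-comm 2 _ ⟩
  ones ¬X + ∣T ∂ X ∣ + 2             ≡⟨ cong (λ z → ones ¬X + ∣T z ∣ + 2) (sym (∂-complement X)) ⟩
  ∣T ¬X ∣ + 2                        ∎)
  where
  open ≤-Reasoning
  ¬X = map not X

classified-via-partner : ∀ {n} (x X : Vec Bool (suc n)) {y o w} → ∂ x ≡ y → ∂ X ≡ y →
  Light X → ones X ≡ o → o ≤ 2 → ∣T y ∣ ≡ w → β (suc n) + 4 ≤ suc n + w → Classified x
classified-via-partner {n} x X ∂x ∂X light refl few refl bound
  with ∂x≡∂y⇒x≡y∨x≡¬y x X (trans ∂x (sym ∂X))
... | inj₁ refl = inj₁ light
... | inj₂ refl =
  inj₂ (complement-heavy X few (subst (λ z → β (suc n) + 4 ≤ suc n + ∣T z ∣) (sym ∂X) bound))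

∫-alternating-heavy : ∀ j c b → β (10 + j) + 2 ≤ ∣T ∫ c (alternating b (9 + j)) ∣
∫-alternating-heavy j c b = begin
  β (10 + j) + 2              ≤⟨ β+2≤2[n-2] j ⟩
  (8 + j) + (8 + j)           ≤⟨ +-monoˡ-≤ (8 + j) half ⟩
  oP + oA + (8 + j)           ≡⟨ +-assoc oP oA (8 + j) ⟩
  oP + (oA + (8 + j))         ≡⟨ cong (oP +_) (sym (weight-alternating b (8 + j))) ⟩
  oP + ∣T A ∣                 ≡⟨ cong (λ z → oP + ∣T z ∣) (sym (∂-∫ c A)) ⟩
  ∣T ∫ c A ∣                  ∎
  where
  open ≤-Reasoning
  A = alternating b (9 + j)
  oP = ones (∫ c A)
  oA = ones A
  double : ∀ m → 2 * m ≡ m + m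
  double = solve-∀
  half : 8 + j ≤ oP + oA
  half = *-cancelˡ-≤ 2 (begin
    2 * (8 + j)               ≡⟨ double (8 + j) ⟩
    (8 + j) + (8 + j)         ≤⟨ +-mono-≤ (≤-pred (ones-∫-alternating c b (9 + j)))
                                          (≤-pred (ones-alternating b (9 + j))) ⟩
    2 * oP + 2 * oA           ≡⟨ sym (*-distribˡ-+ 2 oP oA) ⟩
    2 * (oP + oA)             ∎)

light-∂⇒classified : ∀ j (x : Vec Bool (10 + j)) {y} → ∂ x ≡ y → Light y → Classified x
light-∂⇒classified j x d 0ⁿ-light
  with ∂x≡∂y⇒x≡y∨x≡¬y x (0ⁿ (10 + j)) (trans d (sym (∂-replicate (9 + j) false)))
... | inj₁ refl = inj₁ 0ⁿ-light
... | inj₂ refl = inj₁ (subst Light (sym (map-replicate not false (10 + j))) 1ⁿ-light)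
light-∂⇒classified j x d 1ⁿ-light
  with ∂x≡∂y⇒x≡y∨x≡¬y x (alternating false (10 + j)) (trans d (sym (∂-alternating false (9 + j))))
... | inj₁ refl = inj₁ (alternating-light false)
... | inj₂ refl = inj₁ (subst Light (sym (map-not-alternating false (10 + j))) (alternating-light true))
light-∂⇒classified j x d (alternating-light b) =
  inj₂ (subst (λ z → β (10 + j) + 2 ≤ ∣T z ∣) (trans (cong (∫ (head x)) (sym d)) (∫-∂ x))
              (∫-alternating-heavy j (head x) b))
light-∂⇒classified j x d 10ⁿ-light =
  classified-via-partner x (true ∷ 0ⁿ (9 + j)) d (∂-∷-0ⁿ (8 + j) true) 10ⁿ-light
    (cong suc (ones-0ⁿ (9 + j))) (s≤s z≤n) (weight-10ⁿ (8 + j)) (β+4≤n+[n-1] j)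
light-∂⇒classified j x d 010ⁿ-light =
  classified-via-partner x (true ∷ true ∷ 0ⁿ (8 + j)) d (cong (false ∷_) (∂-∷-0ⁿ (7 + j) true)) 110ⁿ-light
    (cong (2 +_) (ones-0ⁿ (8 + j))) ≤-refl (weight-010ⁿ (7 + j)) (β+4≤n+q j _ ≤-refl)
light-∂⇒classified j x d 110ⁿ-light =
  classified-via-partner x (false ∷ true ∷ 0ⁿ (8 + j)) d (cong (true ∷_) (∂-∷-0ⁿ (7 + j) true)) 010ⁿ-light
    (cong suc (ones-0ⁿ (8 + j))) (s≤s z≤n) (weight-110ⁿ (7 + j))
    (β+4≤n+q j _ (β-suc-≤ (9 + j)))
light-∂⇒classified j x d 0ⁿ1-light =
  classified-via-partner x (0ⁿ (9 + j) ∷ʳ true) d (∂-0ⁿ-∷ʳ (8 + j) true) 0ⁿ1-light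
    (ones-0ⁿ-∷ʳ (9 + j) true) (s≤s z≤n) (weight-0ⁿ1 (8 + j)) (β+4≤n+[n-1] j)
light-∂⇒classified j x d 0ⁿ10-light =
  classified-via-partner x (0ⁿ (8 + j) ∷ʳ true ∷ʳ true) d (∂-0ⁿ-∷ʳ-∷ʳ (7 + j) true true) 0ⁿ11-light
    (ones-0ⁿ-∷ʳ-∷ʳ (8 + j) true true) ≤-refl (weight-0ⁿ10 (7 + j)) (β+4≤n+q j _ ≤-refl)
light-∂⇒classified j x d 0ⁿ11-light =
  classified-via-partner x (0ⁿ (8 + j) ∷ʳ true ∷ʳ false) d (∂-0ⁿ-∷ʳ-∷ʳ (7 + j) true false) 0ⁿ10-light
    (ones-0ⁿ-∷ʳ-∷ʳ (8 + j) true false) (s≤s z≤n) (weight-0ⁿ11 (7 + j))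
    (β+4≤n+q j _ (β-suc-≤ (9 + j)))

-- Words with a single one

-- placed p a m is the prefix of length m of the infinite word 0ᵃ·p·000⋯.
placed : ∀ {k} → Vec Bool k → ℕ → (m : ℕ) → Vec Bool m
placed p a zero = []
placed p (suc a) (suc m) = false ∷ placed p a m
placed [] zero (suc m) = false ∷ placed [] zero m
placed (c ∷ p) zero (suc m) = c ∷ placed p zero m

placed-[] : ∀ a m → placed [] a m ≡ 0ⁿ m
placed-[] a zero = refl
placed-[] (suc a) (suc m) = cong (false ∷_) (placed-[] a m)
placed-[] zero (suc m) = cong (false ∷_) (placed-[] zero m)

∂-placed-0 : ∀ {k} (p : Vec Bool (suc k)) m → ∂ (placed p 0 (suc m)) ≡ placed (∂ (p ∷ʳ false)) 0 m
∂-placed-0 (c ∷ p) zero = refl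
∂-placed-0 (c ∷ []) (suc m) =
  cong ((c xor false) ∷_) (trans (cong ∂ (placed-[] 0 (suc m))) (trans (∂-replicate m false) (sym (placed-[] 0 m))))
∂-placed-0 (c ∷ d ∷ p) (suc m) = cong ((c xor d) ∷_) (∂-placed-0 (d ∷ p) m)

∂-placed : ∀ {k} (p : Vec Bool k) a m → ∂ (placed p (suc a) (suc m)) ≡ placed (∂ (false ∷ (p ∷ʳ false))) a m
∂-placed p zero m = ∂-placed-0 (false ∷ p) m
∂-placed p (suc a) zero = refl
∂-placed p (suc a) (suc m) = cong (false ∷_) (∂-placed p a m)

ones-placed-≤ : ∀ {k} (p : Vec Bool k) a m → ones (placed p a m) ≤ ones p
ones-placed-≤ p a zero = z≤n
ones-placed-≤ p (suc a) (suc m) = ones-placed-≤ p a m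
ones-placed-≤ [] zero (suc m) = ones-placed-≤ [] zero m
ones-placed-≤ (true ∷ p) zero (suc m) = s≤s (ones-placed-≤ p zero m)
ones-placed-≤ (false ∷ p) zero (suc m) = ones-placed-≤ p zero m

ones-placed-≥ : ∀ {k l} (p : Vec Bool k) (q : Vec Bool l) a m → a + k ≤ m → ones p ≤ ones (placed (p ++ q) a m)
ones-placed-≥ [] q a m fits = z≤n
ones-placed-≥ (c ∷ p) q zero zero ()
ones-placed-≥ (c ∷ p) q (suc a) zero ()
ones-placed-≥ (c ∷ p) q (suc a) (suc m) (s≤s fits) = ones-placed-≥ (c ∷ p) q a m fits
ones-placed-≥ (true ∷ p) q zero (suc m) (s≤s fits) = s≤s (ones-placed-≥ p q zero m fits)
ones-placed-≥ (false ∷ p) q zero (suc m) (s≤s fits) = ones-placed-≥ p q zero m fits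

ones≡1⇒placed : ∀ {m} (x : Vec Bool m) → ones x ≡ 1 → ∃[ a ] a < m × x ≡ placed (true ∷ []) a m
ones≡1⇒placed (true ∷ x) e =
  0 , s≤s z≤n , cong (true ∷_) (trans (ones≡0⇒0ⁿ x (suc-injective e)) (sym (placed-[] 0 _)))
ones≡1⇒placed (false ∷ x) e with ones≡1⇒placed x e
... | a , a<m , refl = suc a , s≤s a<m , refl

placed-0ⁿ1 : ∀ n → placed (true ∷ []) n (suc n) ≡ 0ⁿ n ∷ʳ true
placed-0ⁿ1 zero = refl
placed-0ⁿ1 (suc n) = cong (false ∷_) (placed-0ⁿ1 n)

placed-0ⁿ10 : ∀ n → placed (true ∷ []) n (2 + n) ≡ 0ⁿ n ∷ʳ true ∷ʳ false
placed-0ⁿ10 zero = refl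
placed-0ⁿ10 (suc n) = cong (false ∷_) (placed-0ⁿ10 n)

ones≡1⇒light-or-inner : ∀ n (x : Vec Bool (3 + n)) → ones x ≡ 1 →
  Light x ⊎ ∃[ a ] 2 + a ≤ n × x ≡ placed (true ∷ []) (2 + a) (3 + n)
ones≡1⇒light-or-inner n x e with ones≡1⇒placed x e
... | zero , _ , refl = inj₁ (subst (λ z → Light (true ∷ z)) (sym (placed-[] 0 (2 + n))) 10ⁿ-light)
... | suc zero , _ , refl = inj₁ (subst (λ z → Light (false ∷ true ∷ z)) (sym (placed-[] 0 (1 + n))) 010ⁿ-light)
... | suc (suc a) , s≤s (s≤s a<1+n) , refl with m≤n⇒m<n∨m≡n (≤-pred a<1+n)
...   | inj₂ refl = inj₁ (subst Light (sym (placed-0ⁿ1 (2 + a))) 0ⁿ1-light)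
...   | inj₁ a<n with m≤n⇒m<n∨m≡n a<n
...     | inj₂ refl = inj₁ (subst Light (sym (placed-0ⁿ10 (2 + a))) 0ⁿ10-light)
...     | inj₁ 1+a<n = inj₂ (a , 1+a<n , refl)

ones-∂-via : ∀ {n b o} (y : Vec Bool (suc n)) {z} → ∂ y ≡ z → ones z ≡ o → o ≤ b → ones (∂ y) ≤ b
ones-∂-via y d o le = ≤-trans (≤-reflexive (trans (cong ones d) o)) le

light-ones-∂≤2 : ∀ k {y : Vec Bool (6 + k)} → Light y → ones y ≤ 2 → ones (∂ y) ≤ 2
light-ones-∂≤2 k {y} 0ⁿ-light _ =
  ones-∂-via y (∂-replicate (5 + k) false) (ones-0ⁿ (5 + k)) z≤n
light-ones-∂≤2 k {y} 1ⁿ-light _ =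
  ones-∂-via y (∂-replicate (5 + k) true) (ones-0ⁿ (5 + k)) z≤n
light-ones-∂≤2 k {y} 10ⁿ-light _ =
  ones-∂-via y (∂-∷-0ⁿ (4 + k) true) (cong suc (ones-0ⁿ (4 + k))) (s≤s z≤n)
light-ones-∂≤2 k {y} 010ⁿ-light _ =
  ones-∂-via y (cong (true ∷_) (∂-∷-0ⁿ (3 + k) true)) (cong (2 +_) (ones-0ⁿ (3 + k))) ≤-refl
light-ones-∂≤2 k {y} 110ⁿ-light _ =
  ones-∂-via y (cong (false ∷_) (∂-∷-0ⁿ (3 + k) true)) (cong suc (ones-0ⁿ (3 + k))) (s≤s z≤n)
light-ones-∂≤2 k {y} 0ⁿ1-light _ =
  ones-∂-via y (∂-0ⁿ-∷ʳ (4 + k) true) (ones-0ⁿ-∷ʳ (4 + k) true) (s≤s z≤n)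
light-ones-∂≤2 k {y} 0ⁿ10-light _ =
  ones-∂-via y (∂-0ⁿ-∷ʳ-∷ʳ (3 + k) true false) (ones-0ⁿ-∷ʳ-∷ʳ (3 + k) true true) ≤-refl
light-ones-∂≤2 k {y} 0ⁿ11-light _ =
  ones-∂-via y (∂-0ⁿ-∷ʳ-∷ʳ (3 + k) true true) (ones-0ⁿ-∷ʳ-∷ʳ (3 + k) true false) (s≤s z≤n)
light-ones-∂≤2 k (alternating-light b) few with ≤-trans (ones-alternating b (6 + k)) (s≤s (*-monoʳ-≤ 2 few))
... | s≤s (s≤s (s≤s (s≤s (s≤s ()))))

inner-unit-ones : ∀ {n a} → 3 ≤ n → 2 + a ≤ n → let x = placed (true ∷ []) (2 + a) (3 + n) in
  1 ≤ ones x × 2 ≤ ones (∂ x) × ones (∂ (∂ x)) ≤ 2 × 3 ≤ ones (∂ (∂ (∂ x)))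
inner-unit-ones {n} {a} 3≤n fits =
  ones-placed-≥ (true ∷ []) [] (2 + a) (3 + n) unit-fits ,
  subst (λ z → 2 ≤ ones z) (sym ∂x) (ones-placed-≥ (true ∷ true ∷ []) [] (1 + a) (2 + n) pair-fits) ,
  subst (λ z → ones z ≤ 2) (sym ∂²x) (ones-placed-≤ (true ∷ false ∷ true ∷ []) a (1 + n)) ,
  subst (λ z → 3 ≤ ones z) (sym (cong ∂ ∂²x)) (three a fits)
  where
  unit-fits : (2 + a) + 1 ≤ 3 + n
  unit-fits = s≤s (s≤s (≤-trans (≤-reflexive (+-comm a 1)) (s≤s (≤-trans (m≤n+m a 2) fits))))
  pair-fits : (1 + a) + 2 ≤ 2 + n
  pair-fits = s≤s (≤-trans (≤-reflexive (+-comm a 2)) (≤-trans fits (n≤1+n n)))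
  ∂x : ∂ (placed (true ∷ []) (2 + a) (3 + n)) ≡ placed (true ∷ true ∷ []) (1 + a) (2 + n)
  ∂x = ∂-placed (true ∷ []) (1 + a) (2 + n)
  ∂²x : ∂ (∂ (placed (true ∷ []) (2 + a) (3 + n))) ≡ placed (true ∷ false ∷ true ∷ []) a (1 + n)
  ∂²x = trans (cong ∂ ∂x) (∂-placed (true ∷ true ∷ []) a (1 + n))
  three : ∀ a → 2 + a ≤ n → 3 ≤ ones (∂ (placed (true ∷ false ∷ true ∷ []) a (1 + n)))
  three zero _ = subst (λ z → 3 ≤ ones z) (sym (∂-placed-0 (true ∷ false ∷ true ∷ []) n))
    (ones-placed-≥ (true ∷ true ∷ true ∷ []) [] 0 n 3≤n)
  three (suc a) fits = subst (λ z → 3 ≤ ones z) (sym (∂-placed (true ∷ false ∷ true ∷ []) a n))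
    (ones-placed-≥ (true ∷ true ∷ true ∷ []) (true ∷ []) a n (≤-trans (≤-reflexive (+-comm a 3)) fits))

inner-unit-heavy : ∀ j → Dichotomy (8 + j) → ∀ a → 2 + a ≤ 7 + j →
  β (10 + j) + 2 ≤ ∣T placed (true ∷ []) (2 + a) (10 + j) ∣
inner-unit-heavy j D₈ a fits with inner-unit-ones (s≤s (s≤s (s≤s z≤n))) fits
... | one , two , sparse , three with D₈ (∂ (∂ (placed (true ∷ []) (2 + a) (10 + j))))
...   | inj₁ light with ≤-trans three (light-ones-∂≤2 (2 + j) light sparse)
...     | s≤s (s≤s ())
inner-unit-heavy j D₈ a fits | one , two , sparse , three | inj₂ heavy = +-mono-≤ one (+-mono-≤ two heavy)

-- The dichotomy

dichotomy-step : ∀ j → Dichotomy (8 + j) → Dichotomy (9 + j) → Dichotomy (10 + j)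
dichotomy-step j D₈ D₉ x with D₉ (∂ x)
... | inj₁ ∂x-light = light-∂⇒classified j x refl ∂x-light
... | inj₂ ∂x-heavy = by-ones (ones x) refl
  where
  by-ones : ∀ o → ones x ≡ o → Classified x
  by-ones zero e = inj₁ (subst Light (sym (ones≡0⇒0ⁿ x e)) 0ⁿ-light)
  by-ones (suc (suc o)) e = inj₂ (≤-trans (+-monoˡ-≤ 2 (β-suc-≤ (9 + j)))
                                          (+-mono-≤ (subst (2 ≤_) (sym e) (s≤s (s≤s z≤n))) ∂x-heavy))
  by-ones (suc zero) e with ones≡1⇒light-or-inner (7 + j) x e
  ... | inj₁ light = inj₁ light
  ... | inj₂ (a , fits , x≡) =
    inj₂ (subst (λ z → β (10 + j) + 2 ≤ ∣T z ∣) (sym x≡) (inner-unit-heavy j D₈ a fits))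

∈-allVecs : ∀ {n} (x : Vec Bool n) → x ∈ allVecs n
∈-allVecs [] = here refl
∈-allVecs (c ∷ x) = ∈-concatMap⁺ _ (Any.map (λ { refl → ∈-pair c }) (∈-allVecs x))
  where
  ∈-pair : ∀ c → c ∷ x ∈ (false ∷ x) ∷ (true ∷ x) ∷ []
  ∈-pair false = here refl
  ∈-pair true = there (here refl)

all-by-enumeration : ∀ {n} {P : Vec Bool n → Set} (P? : Decidable P) →
  True (all? P? (allVecs n)) → ∀ x → P x
all-by-enumeration P? ok x = All.lookup (toWitness ok) (∈-allVecs x)

lightWords : ∀ k → List (∃ (Light {2 + k}))
lightWords k =
  (_ , 0ⁿ-light) ∷ (_ , 1ⁿ-light) ∷ (_ , 10ⁿ-light) ∷ (_ , 010ⁿ-light) ∷ (_ , 110ⁿ-light) ∷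
  (_ , 0ⁿ1-light) ∷ (_ , 0ⁿ10-light) ∷ (_ , 0ⁿ11-light) ∷
  (_ , alternating-light false) ∷ (_ , alternating-light true) ∷ []

Certified : ∀ k → (ℕ → Set) → Vec Bool (2 + k) → Set
Certified k H x = Any ((x ≡_) ∘ proj₁) (lightWords k) ⊎ H ∣T x ∣

certified? : ∀ k {H : ℕ → Set} → Decidable H → Decidable (Certified k H)
certified? k H? x = any? (λ y → ≡-decᵥ Bool._≟_ x (proj₁ y)) (lightWords k) ⊎-dec H? ∣T x ∣

certified⇒light : ∀ k {H x} → Certified k H x → Light x ⊎ H ∣T x ∣
certified⇒light k (inj₁ found) with Any.satisfied found
... | (_ , light) , refl = inj₁ light
certified⇒light k (inj₂ h) = inj₂ h

dichotomy-by-enumeration : ∀ k →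
  True (all? (certified? k (λ w → β (2 + k) + 2 ≤? w)) (allVecs (2 + k))) → Dichotomy (2 + k)
dichotomy-by-enumeration k ok =
  certified⇒light k {λ w → β (2 + k) + 2 ≤ w}
    ∘ all-by-enumeration (certified? k (λ w → β (2 + k) + 2 ≤? w)) ok

dichotomy : ∀ j → Dichotomy (8 + j)
dichotomy j = proj₁ (pair j)
  where
  pair : ∀ j → Dichotomy (8 + j) × Dichotomy (9 + j)
  pair zero = dichotomy-by-enumeration 6 tt , dichotomy-by-enumeration 7 tt
  pair (suc j) = proj₂ (pair j) , dichotomy-step j (proj₁ (pair j)) (proj₂ (pair j))

-- Odd lengths

β-odd : ∀ t → β (1 + t * 2) ≡ 1 + t * 3
β-odd zero = refl
β-odd (suc t) = cong (3 +_) (β-odd t)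

π-odd : ∀ t → π (1 + t * 2) ≡ t * 3
π-odd zero = refl
π-odd (suc t) = cong (3 +_) (π-odd t)

β≡1+π-odd : ∀ t → β (1 + t * 2) ≡ suc (π (1 + t * 2))
β≡1+π-odd t = trans (β-odd t) (cong suc (sym (π-odd t)))

n<π-odd : ∀ s → 7 + s * 2 < π (7 + s * 2)
n<π-odd s = subst (7 + s * 2 <_) (sym (π-odd (3 + s)))
  (s≤s (+-monoʳ-≤ 7 (≤-trans (*-monoʳ-≤ s (n≤1+n 2)) (n≤1+n _))))

π<β-odd : ∀ t → π (1 + t * 2) < β (1 + t * 2)
π<β-odd t = ≤-reflexive (sym (β≡1+π-odd t))

n<β-odd : ∀ s → 7 + s * 2 < β (7 + s * 2)
n<β-odd s = <-trans (n<π-odd s) (π<β-odd (3 + s))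

β-closed-form-odd : ∀ t → (3 * (1 + t * 2) ∸ 1) / 2 ≡ β (1 + t * 2)
β-closed-form-odd t = trans (cong (_/ 2) (expand t)) (trans (m*n/n≡m (1 + t * 3) 2) (sym (β-odd t)))
  where
  expand : ∀ t → t * 2 + (1 + t * 2 + (1 + t * 2 + 0)) ≡ (1 + t * 3) * 2
  expand = solve-∀

ones-alternating-true-odd : ∀ t → ones (alternating true (1 + t * 2)) ≡ 1 + t
ones-alternating-true-odd zero = refl
ones-alternating-true-odd (suc t) = cong suc (ones-alternating-true-odd t)

ones-alternating-false-odd : ∀ t → ones (alternating false (1 + t * 2)) ≡ t
ones-alternating-false-odd zero = refl
ones-alternating-false-odd (suc t) = cong suc (ones-alternating-false-odd t)

weight-alternating-true-odd : ∀ t → ∣T alternating true (1 + t * 2) ∣ ≡ β (1 + t * 2)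
weight-alternating-true-odd t = begin
  ∣T alternating true (1 + t * 2) ∣   ≡⟨ weight-alternating true (t * 2) ⟩
  ones (alternating true (1 + t * 2)) + t * 2 ≡⟨ cong (_+ t * 2) (ones-alternating-true-odd t) ⟩
  (1 + t) + t * 2                     ≡⟨ sum t ⟩
  1 + t * 3                           ≡⟨ sym (β-odd t) ⟩
  β (1 + t * 2)                       ∎
  where
  open ≡-Reasoning
  sum : ∀ t → (1 + t) + t * 2 ≡ 1 + t * 3
  sum = solve-∀

weight-alternating-false-odd : ∀ t → ∣T alternating false (1 + t * 2) ∣ ≡ π (1 + t * 2)
weight-alternating-false-odd t = begin
  ∣T alternating false (1 + t * 2) ∣   ≡⟨ weight-alternating false (t * 2) ⟩
  ones (alternating false (1 + t * 2)) + t * 2 ≡⟨ cong (_+ t * 2) (ones-alternating-false-odd t) ⟩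
  t + t * 2                            ≡⟨ sum t ⟩
  t * 3                                ≡⟨ sym (π-odd t) ⟩
  π (1 + t * 2)                        ∎
  where
  open ≡-Reasoning
  sum : ∀ t → t + t * 2 ≡ t * 3
  sum = solve-∀

b₁≡alternating : ∀ n → b₁ n ≡ alternating true n
b₁≡alternating zero = refl
b₁≡alternating (suc zero) = refl
b₁≡alternating (suc (suc n)) = cong (λ v → true ∷ false ∷ v) (b₁≡alternating n)

b₃≡0ⁿ11 : ∀ k → b₃ (2 + k) ≡ 0ⁿ k ∷ʳ true ∷ʳ true
b₃≡0ⁿ11 zero = refl
b₃≡0ⁿ11 (suc k) = cong (false ∷_) (b₃≡0ⁿ11 k)

b₅≡110ⁿ : ∀ k → b₅ (2 + k) ≡ true ∷ true ∷ 0ⁿ k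
b₅≡110ⁿ k = cong (λ v → true ∷ true ∷ v) (all-false k)
  where
  all-false : ∀ k → Vec.tabulate {n = k} (λ _ → false) ≡ 0ⁿ k
  all-false zero = refl
  all-false (suc k) = cong (false ∷_) (all-false k)

-- At n = 7 the classification needs an exception: 0001000 is not light but has weight π 7 = 9.
odd-classification : ∀ s (x : Vec Bool (7 + s * 2)) →
  Light x ⊎ ∣T x ∣ ≡ π (7 + s * 2) ⊎ β (7 + s * 2) < ∣T x ∣
odd-classification zero =
  certified⇒light 5 {λ w → w ≡ π 7 ⊎ β 7 < w}
    ∘ all-by-enumeration (certified? 5 (λ w → (w ≟ π 7) ⊎-dec (β 7 <? w))) tt
odd-classification (suc s) x with dichotomy (1 + s * 2) x
... | inj₁ light = inj₁ light
... | inj₂ heavy = inj₂ (inj₂ (≤-trans (≤-trans (n≤1+n _) (≤-reflexive (+-comm 2 _))) heavy))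

light-weight-odd : ∀ t {n} {x : Vec Bool n} → n ≡ 1 + t * 2 → Light x →
  ∣T x ∣ ≡ 0 ⊎ ∣T x ∣ ≡ n ⊎ ∣T x ∣ ≡ π n
  ⊎ ∣T x ∣ ≡ β n × (x ≡ b₁ n ⊎ x ≡ b₃ n ⊎ x ≡ b₅ n)
light-weight-odd t _ (0ⁿ-light {k}) = inj₁ (weight-0ⁿ k)
light-weight-odd t _ (1ⁿ-light {k}) = inj₂ (inj₁ (weight-1ⁿ k))
light-weight-odd t _ (10ⁿ-light {k}) = inj₂ (inj₁ (weight-10ⁿ k))
light-weight-odd t _ (0ⁿ1-light {k}) = inj₂ (inj₁ (weight-0ⁿ1 k))
light-weight-odd t _ (010ⁿ-light {k}) = inj₂ (inj₂ (inj₁ (weight-010ⁿ k)))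
light-weight-odd t _ (0ⁿ10-light {k}) = inj₂ (inj₂ (inj₁ (weight-0ⁿ10 k)))
light-weight-odd t _ (110ⁿ-light {k}) = inj₂ (inj₂ (inj₂ (weight-110ⁿ k , inj₂ (inj₂ (sym (b₅≡110ⁿ k))))))
light-weight-odd t _ (0ⁿ11-light {k}) = inj₂ (inj₂ (inj₂ (weight-0ⁿ11 k , inj₂ (inj₁ (sym (b₃≡0ⁿ11 k))))))
light-weight-odd t refl (alternating-light false) = inj₂ (inj₂ (inj₁ (weight-alternating-false-odd t)))
light-weight-odd t refl (alternating-light true) =
  inj₂ (inj₂ (inj₂ (weight-alternating-true-odd t , inj₁ (sym (b₁≡alternating _)))))

weight-between-0-and-π : ∀ s (x : Vec Bool (7 + s * 2)) → 0 < ∣T x ∣ → ∣T x ∣ < π (7 + s * 2) →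
  ∣T x ∣ ≡ 7 + s * 2
weight-between-0-and-π s x pos below with odd-classification s x
... | inj₂ (inj₁ w≡π) = ⊥-elim (<-irrefl w≡π below)
... | inj₂ (inj₂ above) = ⊥-elim (<-irrefl refl (<-trans above (<-≤-trans below (π≤β (7 + s * 2)))))
... | inj₁ light with light-weight-odd (3 + s) refl light
...   | inj₁ w≡0 = ⊥-elim (<-irrefl (sym w≡0) pos)
...   | inj₂ (inj₁ w≡n) = w≡n
...   | inj₂ (inj₂ (inj₁ w≡π)) = ⊥-elim (<-irrefl w≡π below)
...   | inj₂ (inj₂ (inj₂ (w≡β , _))) = ⊥-elim (<-irrefl w≡β (<-≤-trans below (π≤β (7 + s * 2))))

weight-β⇒b : ∀ s (x : Vec Bool (7 + s * 2)) → ∣T x ∣ ≡ β (7 + s * 2) →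
  x ≡ b₁ (7 + s * 2) ⊎ x ≡ b₃ (7 + s * 2) ⊎ x ≡ b₅ (7 + s * 2)
weight-β⇒b s x w≡β with odd-classification s x
... | inj₂ (inj₁ w≡π) = ⊥-elim (<-irrefl (trans (sym w≡π) w≡β) (π<β-odd (3 + s)))
... | inj₂ (inj₂ above) = ⊥-elim (<-irrefl (sym w≡β) above)
... | inj₁ light with light-weight-odd (3 + s) refl light
...   | inj₁ w≡0 = ⊥-elim (<-irrefl (trans (sym w≡0) w≡β) (<-trans (s≤s z≤n) (n<β-odd s)))
...   | inj₂ (inj₁ w≡n) = ⊥-elim (<-irrefl (trans (sym w≡n) w≡β) (n<β-odd s))
...   | inj₂ (inj₂ (inj₁ w≡π)) = ⊥-elim (<-irrefl (trans (sym w≡π) w≡β) (π<β-odd (3 + s)))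
...   | inj₂ (inj₂ (inj₂ (_ , is-b))) = is-b

b⇒weight-β : ∀ s {x : Vec Bool (7 + s * 2)} →
  x ≡ b₁ (7 + s * 2) ⊎ x ≡ b₃ (7 + s * 2) ⊎ x ≡ b₅ (7 + s * 2) → ∣T x ∣ ≡ β (7 + s * 2)
b⇒weight-β s (inj₁ refl) = trans (cong ∣T_∣ (b₁≡alternating (7 + s * 2))) (weight-alternating-true-odd (3 + s))
b⇒weight-β s (inj₂ (inj₁ refl)) = trans (cong ∣T_∣ (b₃≡0ⁿ11 (5 + s * 2))) (weight-0ⁿ11 (5 + s * 2))
b⇒weight-β s (inj₂ (inj₂ refl)) = trans (cong ∣T_∣ (b₅≡110ⁿ (5 + s * 2))) (weight-110ⁿ (5 + s * 2))

-- The distinct weights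

module _ (p : ℕ → Bool) where

  filterᵇ-upTo-suc : ∀ m → filterᵇ p (upTo (suc m)) ≡ filterᵇ p (upTo m) List.++ filterᵇ p [ m ]
  filterᵇ-upTo-suc m = trans (cong (filterᵇ p) (sym (upTo-∷ʳ m))) (filter-++ (T? ∘ p) (upTo m) [ m ])

  filterᵇ-upTo-hit : ∀ m → T (p m) → filterᵇ p (upTo (suc m)) ≡ filterᵇ p (upTo m) List.++ [ m ]
  filterᵇ-upTo-hit m pm =
    trans (filterᵇ-upTo-suc m) (cong (filterᵇ p (upTo m) List.++_) (filter-accept (T? ∘ p) pm))

  filterᵇ-upTo-gap : ∀ {a b} → a ≤ b → (∀ v → a ≤ v → v < b → ¬ T (p v)) →
    filterᵇ p (upTo b) ≡ filterᵇ p (upTo a)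
  filterᵇ-upTo-gap {b = zero} z≤n _ = refl
  filterᵇ-upTo-gap {a} {suc b} a≤1+b none with m≤n⇒m<n∨m≡n a≤1+b
  ... | inj₂ refl = refl
  ... | inj₁ a<1+b = begin
    filterᵇ p (upTo (suc b))                    ≡⟨ filterᵇ-upTo-suc b ⟩
    filterᵇ p (upTo b) List.++ filterᵇ p [ b ]
      ≡⟨ cong (filterᵇ p (upTo b) List.++_) (filter-reject (T? ∘ p) (none b a≤b ≤-refl)) ⟩
    filterᵇ p (upTo b) List.++ []               ≡⟨ ++-identityʳ _ ⟩
    filterᵇ p (upTo b)
      ≡⟨ filterᵇ-upTo-gap a≤b (λ v a≤v v<b → none v a≤v (m<n⇒m<1+n v<b)) ⟩
    filterᵇ p (upTo a)                          ∎
    where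
    open ≡-Reasoning
    a≤b = ≤-pred a<1+b

  filterᵇ-upTo-prefix : ∀ {a b} → a ≤ b → ∃[ rest ] filterᵇ p (upTo b) ≡ filterᵇ p (upTo a) List.++ rest
  filterᵇ-upTo-prefix {b = zero} z≤n = [] , sym (++-identityʳ _)
  filterᵇ-upTo-prefix {a} {suc b} a≤1+b with m≤n⇒m<n∨m≡n a≤1+b
  ... | inj₂ refl = [] , sym (++-identityʳ _)
  ... | inj₁ a<1+b with filterᵇ-upTo-prefix (≤-pred a<1+b)
  ...   | rest , e = rest List.++ filterᵇ p [ b ] ,
          trans (filterᵇ-upTo-suc b)
                (trans (cong (List._++ filterᵇ p [ b ]) e) (++-assoc (filterᵇ p (upTo a)) rest _))

attained-intro : ∀ {n v} (x : Vec Bool n) → ∣T x ∣ ≡ v → T (attained n v)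
attained-intro {n} {v} x refl =
  any⁺ (λ y → weightT n y ≡ᵇ v) (Any.map (λ { refl → ≡⇒≡ᵇ v v refl }) (∈-allVecs x))

attained-elim : ∀ {n v} → T (attained n v) → ∃[ x ] ∣T x ∣ ≡ v
attained-elim {n} {v} t with Any.satisfied (any⁻ (λ y → weightT n y ≡ᵇ v) (allVecs n) t)
... | x , hit = x , ≡ᵇ⇒≡ _ _ hit

β≤n*[1+n]-odd : ∀ s → β (7 + s * 2) ≤ (7 + s * 2) * suc (7 + s * 2)
β≤n*[1+n]-odd s = begin
  β n                    ≡⟨ β-odd (3 + s) ⟩
  10 + s * 3             ≤⟨ m≤m+n (10 + s * 3) (4 + s) ⟩
  (10 + s * 3) + (4 + s) ≡⟨ rearrange s ⟩
  n + n                  ≤⟨ +-monoʳ-≤ n (m≤m*n n n) ⟩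
  n + n * n              ≡⟨ sym (*-suc n n) ⟩
  n * suc n              ∎
  where
  open ≤-Reasoning
  n = 7 + s * 2
  rearrange : ∀ s → (10 + s * 3) + (4 + s) ≡ (7 + s * 2) + (7 + s * 2)
  rearrange = solve-∀

w₃-odd : ∀ s → w (7 + s * 2) 3 ≡ just (β (7 + s * 2))
w₃-odd s = begin
  w n 3
    ≡⟨ cong (List.head ∘ List.drop 3) (proj₂ split) ⟩
  List.head (List.drop 3 (filterᵇ p (upTo (suc (β n))) List.++ proj₁ split))
    ≡⟨ cong (λ l → List.head (List.drop 3 (l List.++ proj₁ split))) first-four ⟩
  just (β n)
    ∎
  where
  open ≡-Reasoning
  n = 7 + s * 2
  p = attained n
  split : ∃[ rest ] filterᵇ p (upTo (suc (n * suc n))) ≡ filterᵇ p (upTo (suc (β n))) List.++ rest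
  split = filterᵇ-upTo-prefix p (s≤s (β≤n*[1+n]-odd s))
  unattained : ∀ v → 0 < v → v < π n → ¬ v ≡ n → ¬ T (p v)
  unattained v pos below v≢n t with attained-elim {n} {v} t
  ... | x , refl = v≢n (weight-between-0-and-π s x pos below)
  below-n : filterᵇ p (upTo n) ≡ 0 ∷ []
  below-n = trans
    (filterᵇ-upTo-gap p (s≤s z≤n) λ v 1≤v v<n →
      unattained v 1≤v (<-trans v<n (n<π-odd s)) (λ v≡n → <-irrefl v≡n v<n))
    (filterᵇ-upTo-hit p 0 (attained-intro (0ⁿ n) (weight-0ⁿ n)))
  below-π : filterᵇ p (upTo (π n)) ≡ 0 ∷ n ∷ []
  below-π = trans
    (filterᵇ-upTo-gap p (n<π-odd s) λ v n<v v<π →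
      unattained v (≤-trans (s≤s z≤n) n<v) v<π (λ v≡n → <-irrefl (sym v≡n) n<v))
    (trans (filterᵇ-upTo-hit p n (attained-intro (1ⁿ n) (weight-1ⁿ n))) (cong (List._++ [ n ]) below-n))
  below-β : filterᵇ p (upTo (β n)) ≡ 0 ∷ n ∷ π n ∷ []
  below-β = trans (cong (filterᵇ p ∘ upTo) (β≡1+π-odd (3 + s)))
    (trans (filterᵇ-upTo-hit p (π n) (attained-intro (alternating false n) (weight-alternating-false-odd (3 + s))))
           (cong (List._++ [ π n ]) below-π))
  first-four : filterᵇ p (upTo (suc (β n))) ≡ 0 ∷ n ∷ π n ∷ β n ∷ []
  first-four = trans
    (filterᵇ-upTo-hit p (β n) (attained-intro (alternating true n) (weight-alternating-true-odd (3 + s))))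
    (cong (List._++ [ β n ]) below-β)

odd⇒7+2s : ∀ {n} → 7 ≤ n → n % 2 ≡ 1 → ∃[ s ] n ≡ 7 + s * 2
odd⇒7+2s {n} 7≤n odd = from-half (n / 2) (trans (m≡m%n+[m/n]*n n 2) (cong (_+ (n / 2) * 2) odd))
  where
  from-half : ∀ t → n ≡ 1 + t * 2 → ∃[ s ] n ≡ 7 + s * 2
  from-half (suc (suc (suc s))) e = s , e
  from-half 0 e with subst (7 ≤_) e 7≤n
  ... | s≤s ()
  from-half 1 e with subst (7 ≤_) e 7≤n
  ... | s≤s (s≤s (s≤s ()))
  from-half 2 e with subst (7 ≤_) e 7≤n
  ... | s≤s (s≤s (s≤s (s≤s (s≤s ()))))

theorem6p1 : (n : ℕ) → 7 ≤ n → n % 2 ≡ 1 →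
    (w n 3 ≡ just ((3 * n ∸ 1) / 2))
    × ((x : Vec Bool n) →
        (weightT n x ≡ (3 * n ∸ 1) / 2) ⇔ (x ≡ b₁ n ⊎ x ≡ b₃ n ⊎ x ≡ b₅ n))
theorem6p1 n 7≤n n-odd with odd⇒7+2s 7≤n n-odd
... | s , refl =
  trans (w₃-odd s) (cong just (sym closed-form)) ,
  λ x → mk⇔ (λ e → weight-β⇒b s x (trans e closed-form))
            (λ is-b → trans (b⇒weight-β s is-b) (sym closed-form))
  where
  closed-form : (3 * (7 + s * 2) ∸ 1) / 2 ≡ β (7 + s * 2)
  closed-form = β-closed-form-odd (3 + s)
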